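{- Define the relation $\succ^{\mathit{sub}}$ on $\mathcal{EL}$ GCIs by: $C\sqsubseteq D\ \succ^{\mathit{sub}}\ C'\sqsubseteq D'$ iff $C'=C$, $D\sqsubseteq^\emptyset D'$ and $\{C\sqsubseteq D'\}\not\models C\sqsubseteq D$. Then $\succ^{\mathit{sub}}$ is a well-founded, complete, and one-step generated weakening relation, but it is not polynomial.
   Context: $\mathcal{EL}$ concepts: $C::=A\mid\top\mid C\sqcap C\mid\exists r.C$ ($A$ concept name, $r$ role name), with size = number of occurrences of $\top$, concept names and role names. A GCI $C\sqsubseteq D$ is satisfied by an interpretation $\mathcal{I}$ iff $C^\mathcal{I}\subseteq D^\mathcal{I}$, where $\top^\mathcal{I}=\Delta^\mathcal{I}$, $(C\sqcap D)^\mathcal{I}=C^\mathcal{I}\cap D^\mathcal{I}$, $(\exists r.C)^\mathcal{I}=\{d\mid\exists e\in C^\mathcal{I},(d,e)\in r^\mathcal{I}\}$. $\mathfrak{O}\models\alpha$ iff every model of $\mathfrak{O}$ satisfies $\alpha$; $\mathit{Con}(\mathfrak{O})=\{\alpha\mid\mathfrak{O}\models\alpha\}$; a tautology is $\alpha$ with $\emptyset\models\alpha$; $C\sqsubseteq^\emptyset D$ means $C\sqsubseteq D$ is a tautology. A pre-order (irreflexive, transitive) $\succ$ on GCIs is a weakening relation if $\beta\succ\gamma$ implies $\mathit{Con}(\{\gamma\})\subsetneq\mathit{Con}(\{\beta\})$; well-founded if there is no infinite chain $\beta_1\succ\beta_2\succ\cdots$; complete if every non-tautology $\beta$ has a tautology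 $\gamma$ with $\beta\succ\gamma$; one-step generated if the transitive closure of $\succ_1=\{(\beta,\gamma)\in\succ\mid$ no $\delta$ with $\beta\succ\delta\succ\gamma\}$ equals $\succ$; polynomial if there is a polynomial $p$ such that every $\succ$-chain issuing from any $\beta$ has length at most $p(\text{size of }\beta)$. -}

module Defs where

open import Level using (Level) renaming (suc to lsuc; zero to lzero)
open import Data.Nat using (ℕ; zero; suc; _+_; _*_; _≤_; _<_)
open import Data.List using (List; []; _∷_)
open import Data.List.Relation.Unary.All using (All)
open import Data.Product using (Σ; _×_; ∃; ∃-syntax; _,_)
open import Data.Unit using (⊤)
open import Relation.Nullary using (¬_)
open import Relation.Binary.PropositionalEquality using (_≡_)
open import Relation.Binary.Core using (Rel)
open import Relation.Binary.Construct.Closure.Transitive using (TransClosure)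

ConceptName : Set
ConceptName = ℕ

RoleName : Set
RoleName = ℕ

data Concept : Set where
  atom : ConceptName → Concept
  top  : Concept
  _⊓_  : Concept → Concept → Concept
  ex   : RoleName → Concept → Concept

size : Concept → ℕ
size (atom A) = 1
size top = 1
size (C ⊓ D) = size C + size D
size (ex r C) = 1 + size C

record GCI : Set where
  constructor _⊑_
  field
    lhs : Concept
    rhs : Concept

gciSize : GCI → ℕ
gciSize (C ⊑ D) = size C + size D

-- Interpretations (non-empty domain)
record Interp : Set₁ where
  field
    Δ     : Set
    point : Δ
    conc  : ConceptName → Δ → Set
    role  : RoleName → Δ → Δ → Set

open Interp

⟦_⟧ : Concept → (I : Interp) → Δ I → Set
⟦ atom A ⟧ I d = conc I A d
⟦ top ⟧ I d = ⊤
⟦ C ⊓ D ⟧ I d = ⟦ C ⟧ I d × ⟦ D ⟧ I d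
⟦ ex r C ⟧ I d = Σ (Δ I) λ e → role I r d e × ⟦ C ⟧ I e

_⊨ᵍ_ : Interp → GCI → Set
I ⊨ᵍ (C ⊑ D) = ∀ d → ⟦ C ⟧ I d → ⟦ D ⟧ I d

Ontology : Set
Ontology = List GCI

Model : Interp → Ontology → Set
Model I O = All (I ⊨ᵍ_) O

_⊨_ : Ontology → GCI → Set₁
O ⊨ α = ∀ (I : Interp) → Model I O → I ⊨ᵍ α

Con : Ontology → GCI → Set₁
Con O α = O ⊨ α

Tautology : GCI → Set₁
Tautology α = [] ⊨ α

_⊑∅_ : Concept → Concept → Set₁
C ⊑∅ D = Tautology (C ⊑ D)

_⊊ᶜ_ : GCI → GCI → Set₁
γ ⊊ᶜ β = (∀ α → Con (γ ∷ []) α → Con (β ∷ []) α)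
       × (∃[ α ] (Con (β ∷ []) α × ¬ Con (γ ∷ []) α))

Relᴳ : Set₂
Relᴳ = GCI → GCI → Set₁

-- pre-order in the paper's sense: irreflexive and transitive
IsPreOrder : Relᴳ → Set₁
IsPreOrder _≻_ = (∀ β → ¬ (β ≻ β))
               × (∀ β γ δ → β ≻ γ → γ ≻ δ → β ≻ δ)

IsWeakening : Relᴳ → Set₁
IsWeakening _≻_ = IsPreOrder _≻_ × (∀ β γ → β ≻ γ → γ ⊊ᶜ β)

WellFoundedᴳ : Relᴳ → Set₁
WellFoundedᴳ _≻_ = ¬ (Σ (ℕ → GCI) λ f → ∀ i → f i ≻ f (suc i))

Complete : Relᴳ → Set₁
Complete _≻_ = ∀ β → ¬ Tautology β → Σ GCI λ γ → Tautology γ × (β ≻ γ)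

OneStep : Relᴳ → Relᴳ
OneStep _≻_ β γ = (β ≻ γ) × ¬ (Σ GCI λ δ → (β ≻ δ) × (δ ≻ γ))

OneStepGenerated : Relᴳ → Set₁
OneStepGenerated _≻_ =
  ∀ β γ → (TransClosure (OneStep _≻_) β γ → β ≻ γ)
        × (β ≻ γ → TransClosure (OneStep _≻_) β γ)

-- polynomials with natural-number coefficients (list of coefficients, lowest degree first)
Poly : Set
Poly = List ℕ

evalPoly : Poly → ℕ → ℕ
evalPoly [] n = 0
evalPoly (c ∷ cs) n = c + n * evalPoly cs n

ChainFrom : Relᴳ → GCI → ℕ → Set₁
ChainFrom _≻_ β m = Σ (ℕ → GCI) λ f → (f 0 ≡ β) × (∀ i → i < m → f i ≻ f (suc i))

Polynomial : Relᴳ → Set₁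
Polynomial _≻_ = Σ Poly λ p → ∀ β m → ChainFrom _≻_ β m → m ≤ evalPoly p (gciSize β)

_≻sub_ : Relᴳ
(C ⊑ D) ≻sub (C' ⊑ D') = (C' ≡ C) × (D ⊑∅ D') × ¬ ((C ⊑ D' ∷ []) ⊨ (C ⊑ D))

module Submission where

-- Tautologies X ⊑∅ F, and entailments {C ⊑ G} ⊨ X ⊑ F, are decidable: both are read off a
-- canonical model whose elements are concepts, which for {C ⊑ G} is saturated in rounds that
-- stabilise on the finitely many subconcepts of X and G.
--
-- Every H entailed by D is equivalent to the conjunction of those members of a finite set of
-- generators of D that H entails.  The number of generators entailed by the right-hand side is
-- therefore a rank that strictly drops along ≻sub, which gives well-foundedness; and since only
-- the finitely many such normal forms have to be tried as intermediate steps, every ≻sub-step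
-- decomposes into one-step ones.
--
-- For non-polynomiality, with a fresh name A₀ on the left, A₀ ⊑ u ≻sub A₀ ⊑ v whenever u is
-- strictly stronger than v.  A strictly weakening chain of length m from x₀ down to ⊤ doubles,
-- with one fresh name, to a chain of length 2m + 1 from ∃0.(Aₙ₊₁ ⊓ x₀), so the concepts
-- ∃0.(Aₙ ⊓ ∃0.(Aₙ₋₁ ⊓ ⋯ ∃0.(A₁ ⊓ ⊤))) of size 2n + 1 start chains of length 2ⁿ − 1.

open import Defs
open import Level using (_⊔_)
open import Data.Bool using (Bool; true; false; T; _∨_)
open import Data.Bool.Properties using (T-∨)
open import Data.Empty using (⊥; ⊥-elim)
open import Data.List using (List; []; _∷_; _++_; map; length; filter)
open import Data.List.Properties using (length-filter)
open import Data.List.Membership.Propositional using (_∈_; _∉_; find; lose)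
open import Data.List.Membership.Propositional.Properties
  using (∈-++⁺ˡ; ∈-++⁺ʳ; ∈-++⁻; ∈-map⁺; ∈-filter⁺; ∈-filter⁻)
open import Data.List.Relation.Unary.All using (All; []; _∷_)
import Data.List.Relation.Unary.All as All
import Data.List.Relation.Unary.All.Properties as All
open import Data.List.Relation.Unary.Any using (Any; here; there; any?)
open import Data.List.Relation.Binary.Sublist.Propositional using (_⊆_; ⊆-refl)
open import Data.List.Relation.Binary.Sublist.Propositional.Properties using (filter⁺; length-mono-≤; to-≋)
open import Data.List.Relation.Binary.Pointwise using (Pointwise-≡⇒≡)
open import Data.Nat
  using (ℕ; zero; suc; _+_; _*_; _^_; _≤_; _<_; _≤′_; ≤′-refl; ≤′-step; z≤n; s≤s; _≟_; >-nonZero)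
open import Data.Nat.Properties
open import Data.Nat.ListAction using (sum)
open import Data.Nat.Solver using (module +-*-Solver)
open import Data.List.Membership.DecPropositional _≟_ using (_∈?_)
open import Data.Product using (_×_; _,_; proj₁; proj₂; ∃-syntax)
import Data.Product as Product
open import Data.Product.Function.NonDependent.Propositional using (_×-⇔_)
open import Data.Sum using (_⊎_; inj₁; inj₂)
import Data.Sum as Sum
open import Data.Unit using (⊤; tt)
open import Function.Base using (_∘_; id)
open import Function.Bundles using (_⇔_; mk⇔; Equivalence)
open import Function.Construct.Identity using (⇔-id)
open import Relation.Binary.PropositionalEquality using (_≡_; refl; sym; trans; cong; cong₂; subst)
open import Relation.Binary.Construct.Closure.Transitive using (TransClosure; [_]; _∷_)
  renaming (_++_ to _++⁺_)
open import Relation.Nullary using (¬_; Dec; yes; no; does)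
open import Relation.Nullary.Decidable
  using (_×-dec_; _⊎-dec_; ¬?; T?; map′; isYes; toWitness; fromWitness; does-⇔)
open import Relation.Unary using (Pred; Decidable)
open +-*-Solver using (solve; _:=_; _:+_; _:*_; con)
open Interp

⊑∅-refl : ∀ X → X ⊑∅ X
⊑∅-refl X I _ d x = x

⊑∅-trans : ∀ X Y Z → X ⊑∅ Y → Y ⊑∅ Z → X ⊑∅ Z
⊑∅-trans X Y Z X⊑Y Y⊑Z I M d x = Y⊑Z I M d (X⊑Y I M d x)

axiom-⊨ : ∀ α → (α ∷ []) ⊨ α
axiom-⊨ α I (I⊨α ∷ []) = I⊨α

single-cut : ∀ {β γ} α → (β ∷ []) ⊨ γ → (γ ∷ []) ⊨ α → (β ∷ []) ⊨ α
single-cut α β⊨γ γ⊨α I (I⊨β ∷ []) = γ⊨α I (β⊨γ I (I⊨β ∷ []) ∷ [])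

tautology-cut : ∀ {γ} α → Tautology γ → (γ ∷ []) ⊨ α → Tautology α
tautology-cut α ⊨γ γ⊨α I [] = γ⊨α I (⊨γ I [] ∷ [])

strengthen-rhs : ∀ C D D' → D ⊑∅ D' → ((C ⊑ D) ∷ []) ⊨ (C ⊑ D')
strengthen-rhs C D D' t I (C⊑D ∷ []) d c = t I [] d (C⊑D d c)

⊑∅-ex-mono : ∀ r X Y → X ⊑∅ Y → ex r X ⊑∅ ex r Y
⊑∅-ex-mono r X Y X⊑Y I M d (e , re , x) = e , re , X⊑Y I M e x

⟦⟧-hom : (I J : Interp) (h : Δ I → Δ J) →
         (∀ A d → conc I A d → conc J A (h d)) →
         (∀ r d e → role I r d e → role J r (h d) (h e)) →
         ∀ F d → ⟦ F ⟧ I d → ⟦ F ⟧ J (h d)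
⟦⟧-hom I J h hc hr (atom A) d x = hc A d x
⟦⟧-hom I J h hc hr top d x = tt
⟦⟧-hom I J h hc hr (F ⊓ G) d (x , y) = ⟦⟧-hom I J h hc hr F d x , ⟦⟧-hom I J h hc hr G d y
⟦⟧-hom I J h hc hr (ex r F) d (e , re , x) = h e , hr r d e re , ⟦⟧-hom I J h hc hr F e x

atoms : Concept → List ConceptName
atoms (atom A) = A ∷ []
atoms top = []
atoms (C ⊓ D) = atoms C ++ atoms D
atoms (ex r C) = []

successors : Concept → List (RoleName × Concept)
successors (atom A) = []
successors top = []
successors (C ⊓ D) = successors C ++ successors D
successors (ex r C) = (r , C) ∷ []

∈-atoms-sound : ∀ I X {d A} → ⟦ X ⟧ I d → A ∈ atoms X → ⟦ atom A ⟧ I d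
∈-atoms-sound I (atom A) x (here refl) = x
∈-atoms-sound I (X ⊓ Y) (x , y) m with ∈-++⁻ (atoms X) m
... | inj₁ m = ∈-atoms-sound I X x m
... | inj₂ m = ∈-atoms-sound I Y y m

∈-successors-sound : ∀ I X {d r Z} → ⟦ X ⟧ I d → (r , Z) ∈ successors X → ⟦ ex r Z ⟧ I d
∈-successors-sound I (X ⊓ Y) (x , y) m with ∈-++⁻ (successors X) m
... | inj₁ m = ∈-successors-sound I X x m
... | inj₂ m = ∈-successors-sound I Y y m
∈-successors-sound I (ex r X) x (here refl) = x

-- The elements are concepts; P marks those Y for which Y ⊑ G is already known, and these
-- additionally receive the top-level atoms and successors of G.
canonical : Concept → (Concept → Set) → Interp
canonical G P = record
  { Δ     = Concept
  ; point = top
  ; conc  = λ A Y → A ∈ atoms Y ⊎ (P Y × A ∈ atoms G)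
  ; role  = λ r Y Z → (r , Z) ∈ successors Y ⊎ (P Y × (r , Z) ∈ successors G)
  }

module _ (G : Concept) {P : Concept → Set} where

  private
    M = canonical G P

  canonical-sat : ∀ X {Y} → (∀ {A} → A ∈ atoms X → conc M A Y) →
                  (∀ {r Z} → (r , Z) ∈ successors X → role M r Y Z) → ⟦ X ⟧ M Y
  canonical-sat (atom A) hA hr = hA (here refl)
  canonical-sat top hA hr = tt
  canonical-sat (X ⊓ X') hA hr =
    canonical-sat X (hA ∘ ∈-++⁺ˡ) (hr ∘ ∈-++⁺ˡ) ,
    canonical-sat X' (hA ∘ ∈-++⁺ʳ (atoms X)) (hr ∘ ∈-++⁺ʳ (successors X))
  canonical-sat (ex r X) hA hr = X , hr (here refl) , canonical-sat X inj₁ inj₁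

  canonical-self : ∀ X → ⟦ X ⟧ M X
  canonical-self X = canonical-sat X inj₁ inj₁

  module _ {O : Ontology} (P-sound : ∀ Y → P Y → O ⊨ (Y ⊑ G)) where

    canonical-conc-sound : ∀ {A Y} → conc M A Y → O ⊨ (Y ⊑ atom A)
    canonical-conc-sound {Y = Y} (inj₁ m) I _ d y = ∈-atoms-sound I Y y m
    canonical-conc-sound {Y = Y} (inj₂ (p , m)) I I⊨O d y = ∈-atoms-sound I G (P-sound Y p I I⊨O d y) m

    canonical-role-sound : ∀ {r Y Z} → role M r Y Z → O ⊨ (Y ⊑ ex r Z)
    canonical-role-sound {Y = Y} (inj₁ m) I _ d y = ∈-successors-sound I Y y m
    canonical-role-sound {Y = Y} (inj₂ (p , m)) I I⊨O d y = ∈-successors-sound I G (P-sound Y p I I⊨O d y) m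

    canonical-sound : ∀ F {X} → ⟦ F ⟧ M X → O ⊨ (X ⊑ F)
    canonical-sound (atom A) x = canonical-conc-sound x
    canonical-sound top x I _ d _ = tt
    canonical-sound (F ⊓ F') (x , x') I I⊨O d y =
      canonical-sound F x I I⊨O d y , canonical-sound F' x' I I⊨O d y
    canonical-sound (ex r F) (Z , rXZ , z) I I⊨O d x with canonical-role-sound rXZ I I⊨O d x
    ... | e , re , ze = e , re , canonical-sound F z I I⊨O e ze

∃-successor? : ∀ r {Q : Concept → Set} → Decidable Q → ∀ xs → Dec (∃[ Z ] ((r , Z) ∈ xs × Q Z))
∃-successor? r {Q} Q? xs =
  map′ found (λ (Z , m , q) → lose {P = Edge} m (refl , q)) (any? (λ (s , Z) → (r ≟ s) ×-dec Q? Z) xs)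
  where
  Edge : RoleName × Concept → Set
  Edge (s , Z) = r ≡ s × Q Z
  found : Any Edge xs → ∃[ Z ] ((r , Z) ∈ xs × Q Z)
  found a with find a
  ... | _ , m , refl , q = _ , m , q

module _ (G : Concept) {P : Concept → Set} where

  canonical? : Decidable P → ∀ F → Decidable (⟦ F ⟧ (canonical G P))
  canonical? P? (atom A) Y = (A ∈? atoms Y) ⊎-dec (P? Y ×-dec (A ∈? atoms G))
  canonical? P? top Y = yes tt
  canonical? P? (F ⊓ F') Y = canonical? P? F Y ×-dec canonical? P? F' Y
  canonical? P? (ex r F) Y =
    map′ join split (successor? (successors Y) ⊎-dec (P? Y ×-dec successor? (successors G)))
    where
    successor? = ∃-successor? r (canonical? P? F)
    join : ∃[ Z ] ((r , Z) ∈ successors Y × ⟦ F ⟧ (canonical G P) Z) ⊎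
           (P Y × ∃[ Z ] ((r , Z) ∈ successors G × ⟦ F ⟧ (canonical G P) Z)) →
           ⟦ ex r F ⟧ (canonical G P) Y
    join (inj₁ (Z , m , z)) = Z , inj₁ m , z
    join (inj₂ (p , Z , m , z)) = Z , inj₂ (p , m) , z
    split : ⟦ ex r F ⟧ (canonical G P) Y →
            ∃[ Z ] ((r , Z) ∈ successors Y × ⟦ F ⟧ (canonical G P) Z) ⊎
            (P Y × ∃[ Z ] ((r , Z) ∈ successors G × ⟦ F ⟧ (canonical G P) Z))
    split (Z , inj₁ m , z) = inj₁ (Z , m , z)
    split (Z , inj₂ (p , m) , z) = inj₂ (p , Z , m , z)

module _ (G : Concept) {P Q : Concept → Set} where

  canonical-mono : (∀ {Y} → P Y → Q Y) →
                   ∀ F {Y} → ⟦ F ⟧ (canonical G P) Y → ⟦ F ⟧ (canonical G Q) Y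
  canonical-mono P⊆Q F {Y} = ⟦⟧-hom (canonical G P) (canonical G Q) (λ Y → Y)
    (λ _ _ → Sum.map₂ (Product.map₁ P⊆Q)) (λ _ _ _ → Sum.map₂ (Product.map₁ P⊆Q)) F Y

  canonical-local : (N : List Concept) →
                    (∀ {Y r Z} → Y ∈ N → (r , Z) ∈ successors Y → Z ∈ N) →
                    (∀ {r Z} → (r , Z) ∈ successors G → Z ∈ N) →
                    (∀ {Y} → Y ∈ N → P Y → Q Y) →
                    ∀ F {Y} → Y ∈ N → ⟦ F ⟧ (canonical G P) Y → ⟦ F ⟧ (canonical G Q) Y
  canonical-local N closed G-closed P⊆Q = go
    where
    go : ∀ F {Y} → Y ∈ N → ⟦ F ⟧ (canonical G P) Y → ⟦ F ⟧ (canonical G Q) Y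
    go (atom A) Y∈N (inj₁ m) = inj₁ m
    go (atom A) Y∈N (inj₂ (p , m)) = inj₂ (P⊆Q Y∈N p , m)
    go top Y∈N y = tt
    go (F ⊓ F') Y∈N (y , y') = go F Y∈N y , go F' Y∈N y'
    go (ex r F) Y∈N (Z , inj₁ m , z) = Z , inj₁ m , go F (closed Y∈N m) z
    go (ex r F) Y∈N (Z , inj₂ (p , m) , z) = Z , inj₂ (P⊆Q Y∈N p , m) , go F (G-closed m) z

canonical∅ : Interp
canonical∅ = canonical top (λ _ → ⊥)

⊑∅⇒canonical∅ : ∀ {X} F → X ⊑∅ F → ⟦ F ⟧ canonical∅ X
⊑∅⇒canonical∅ {X} F X⊑F = X⊑F canonical∅ [] X (canonical-self top X)

canonical∅⇒⊑∅ : ∀ X F → ⟦ F ⟧ canonical∅ X → X ⊑∅ F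
canonical∅⇒⊑∅ X F = canonical-sound top (λ _ ()) F {X}

_⊑∅?_ : ∀ X F → Dec (X ⊑∅ F)
X ⊑∅? F = map′ (canonical∅⇒⊑∅ X F) (⊑∅⇒canonical∅ F) (canonical? top (λ _ → no λ ()) F X)

⊑∅-atom : ∀ X {A} → X ⊑∅ atom A → A ∈ atoms X
⊑∅-atom X {A} X⊑A with ⊑∅⇒canonical∅ {X} (atom A) X⊑A
... | inj₁ m = m

⊑∅-ex : ∀ X {r H} → X ⊑∅ ex r H → ∃[ Z ] ((r , Z) ∈ successors X × Z ⊑∅ H)
⊑∅-ex X {r} {H} X⊑∃rH with ⊑∅⇒canonical∅ {X} (ex r H) X⊑∃rH
... | Z , inj₁ m , z = Z , m , canonical∅⇒⊑∅ Z H z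

top⋢∅ex : ∀ r H → ¬ (top ⊑∅ ex r H)
top⋢∅ex r H t with ⊑∅-ex top {r} {H} t
... | _ , () , _

module _ {a p q} {A : Set a} {P : Pred A p} {Q : Pred A q}
         (P? : Decidable P) (Q? : Decidable Q) (P⊆Q : ∀ {x} → P x → Q x) where

  private
    filter-⊆ : ∀ xs → filter P? xs ⊆ filter Q? xs
    filter-⊆ xs = filter⁺ P? Q? (λ { refl → P⊆Q }) (⊆-refl {x = xs})

  count-mono : ∀ xs → length (filter P? xs) ≤ length (filter Q? xs)
  count-mono xs = length-mono-≤ (filter-⊆ xs)

  count-≡⇒⊇ : ∀ {xs} → length (filter P? xs) ≡ length (filter Q? xs) →
              ∀ {x} → x ∈ xs → Q x → P x
  count-≡⇒⊇ {xs} eq x∈xs qx =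
    proj₂ (∈-filter⁻ P? {xs = xs} (subst (_ ∈_) (sym filters-≡) (∈-filter⁺ Q? x∈xs qx)))
    where
    filters-≡ : filter P? xs ≡ filter Q? xs
    filters-≡ = Pointwise-≡⇒≡ (to-≋ eq (filter-⊆ xs))

T-⇔⇒≡ : ∀ {a b} → (T a → T b) → (T b → T a) → a ≡ b
T-⇔⇒≡ f g = does-⇔ (mk⇔ f g) (T? _) (T? _)

module Stabilisation {A : Set} (s : ℕ → A → Bool) (N : List A)
  (s-inflationary : ∀ {k x} → T (s k x) → T (s (suc k) x))
  (s-local : ∀ {k j} → (∀ {x} → x ∈ N → s k x ≡ s j x) →
                       ∀ {x} → x ∈ N → s (suc k) x ≡ s (suc j) x)
  where

  Agree : ℕ → ℕ → Set
  Agree k j = ∀ {x} → x ∈ N → s k x ≡ s j x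

  count : ℕ → ℕ
  count k = length (filter (T? ∘ s k) N)

  count-≡⇒stable : ∀ k → count k ≡ count (suc k) → Agree k (suc k)
  count-≡⇒stable k eq x∈N =
    T-⇔⇒≡ s-inflationary (count-≡⇒⊇ (T? ∘ s k) (T? ∘ s (suc k)) s-inflationary eq x∈N)

  -- Until it stabilises, the number of x ∈ N with s k x grows by at least one per step.
  stable-or-grows : ∀ k → Agree k (suc k) ⊎ k ≤ count k
  stable-or-grows zero = inj₂ z≤n
  stable-or-grows (suc k) with stable-or-grows k | count k ≟ count (suc k)
  ... | inj₁ stable | _ = inj₁ (s-local stable)
  ... | inj₂ _ | yes eq = inj₁ (s-local (count-≡⇒stable k eq))
  ... | inj₂ k≤count | no neq =
    inj₂ (<-≤-trans (s≤s k≤count) (≤∧≢⇒< (count-mono _ _ s-inflationary N) neq))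

  bound : ℕ
  bound = suc (length N)

  stable-at-bound : Agree bound (suc bound)
  stable-at-bound with stable-or-grows bound
  ... | inj₁ stable = stable
  ... | inj₂ bound≤count = ⊥-elim (<-irrefl refl (≤-trans bound≤count (length-filter _ N)))

  stabilised : ∀ i → Agree bound (i + bound)
  stabilised zero x∈N = refl
  stabilised (suc i) x∈N = trans (stabilised i x∈N) (stabilise-step i x∈N)
    where
    stabilise-step : ∀ i → Agree (i + bound) (suc i + bound)
    stabilise-step zero = stable-at-bound
    stabilise-step (suc i) = s-local (stabilise-step i)

subconcepts : Concept → List Concept
subconcepts (atom A) = atom A ∷ []
subconcepts top = top ∷ []
subconcepts (X ⊓ Y) = (X ⊓ Y) ∷ (subconcepts X ++ subconcepts Y)
subconcepts (ex r X) = ex r X ∷ subconcepts X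

subconcepts-self : ∀ X → X ∈ subconcepts X
subconcepts-self (atom A) = here refl
subconcepts-self top = here refl
subconcepts-self (X ⊓ Y) = here refl
subconcepts-self (ex r X) = here refl

subconcepts-trans : ∀ X {Y Z} → Y ∈ subconcepts X → Z ∈ subconcepts Y → Z ∈ subconcepts X
subconcepts-trans (atom A) (here refl) Z∈Y = Z∈Y
subconcepts-trans top (here refl) Z∈Y = Z∈Y
subconcepts-trans (X ⊓ X') (here refl) Z∈Y = Z∈Y
subconcepts-trans (X ⊓ X') (there Y∈) Z∈Y with ∈-++⁻ (subconcepts X) Y∈
... | inj₁ Y∈X = there (∈-++⁺ˡ (subconcepts-trans X Y∈X Z∈Y))
... | inj₂ Y∈X' = there (∈-++⁺ʳ (subconcepts X) (subconcepts-trans X' Y∈X' Z∈Y))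
subconcepts-trans (ex r X) (here refl) Z∈Y = Z∈Y
subconcepts-trans (ex r X) (there Y∈X) Z∈Y = there (subconcepts-trans X Y∈X Z∈Y)

successor∈subconcepts : ∀ Y {r Z} → (r , Z) ∈ successors Y → Z ∈ subconcepts Y
successor∈subconcepts (Y ⊓ Y') m with ∈-++⁻ (successors Y) m
... | inj₁ m = there (∈-++⁺ˡ (successor∈subconcepts Y m))
... | inj₂ m = there (∈-++⁺ʳ (subconcepts Y) (successor∈subconcepts Y' m))
successor∈subconcepts (ex r Y) (here refl) = there (subconcepts-self Y)

module Saturation (C G : Concept) where

  O : Ontology
  O = (C ⊑ G) ∷ []

  stage : ℕ → Concept → Bool
  model : ℕ → Interp
  model k = canonical G (T ∘ stage k)

  C-holds? : ∀ k → Decidable (⟦ C ⟧ (model k))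
  C-holds? k = canonical? G (T? ∘ stage k) C

  stage zero Y = false
  stage (suc k) Y = stage k Y ∨ isYes (C-holds? k Y)

  stage-sound : ∀ k Y → T (stage k Y) → O ⊨ (Y ⊑ G)
  stage-sound (suc k) Y t with Equivalence.to T-∨ t
  ... | inj₁ t = stage-sound k Y t
  ... | inj₂ t = λ { I I⊨O@(C⊑G ∷ []) d y →
                      C⊑G d (canonical-sound G (stage-sound k) C (toWitness {a? = C-holds? k Y} t) I I⊨O d y) }

  stage-inflationary : ∀ {k Y} → T (stage k Y) → T (stage (suc k) Y)
  stage-inflationary t = Equivalence.from T-∨ (inj₁ t)

  stage-mono : ∀ {k k' Y} → k ≤ k' → T (stage k Y) → T (stage k' Y)
  stage-mono = go ∘ ≤⇒≤′
    where
    go : ∀ {k k' Y} → k ≤′ k' → T (stage k Y) → T (stage k' Y)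
    go ≤′-refl t = t
    go (≤′-step {n} k≤k') t = stage-inflationary {n} (go k≤k' t)

  model-mono : ∀ {k k'} → k ≤ k' → ∀ F {X} → ⟦ F ⟧ (model k) X → ⟦ F ⟧ (model k') X
  model-mono k≤k' = canonical-mono G (stage-mono k≤k')

  -- The union of all rounds is a model of O, and anything true in it is true after finitely
  -- many rounds; this is what makes the rounds complete.
  Derived : Concept → Set
  Derived Y = ∃[ k ] T (stage k Y)

  limit : Interp
  limit = canonical G Derived

  limit⇒model : ∀ F {Y} → ⟦ F ⟧ limit Y → ∃[ k ] ⟦ F ⟧ (model k) Y
  limit⇒model (atom A) (inj₁ m) = 0 , inj₁ m
  limit⇒model (atom A) (inj₂ ((k , t) , m)) = k , inj₂ (t , m)
  limit⇒model top y = 0 , tt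
  limit⇒model (F ⊓ F') (y , y') with limit⇒model F y | limit⇒model F' y'
  ... | k , z | k' , z' = k + k' , model-mono (m≤m+n k k') F z , model-mono (m≤n+m k' k) F' z'
  limit⇒model (ex r F) (Z , inj₁ m , z) with limit⇒model F z
  ... | k , z = k , Z , inj₁ m , z
  limit⇒model (ex r F) {Y} (Z , inj₂ ((k , t) , m) , z) with limit⇒model F z
  ... | k' , z = k + k' , Z , inj₂ (stage-mono (m≤m+n k k') t , m) , model-mono (m≤n+m k' k) F z

  limit-model : Model limit O
  limit-model = C⊑G ∷ []
    where
    C⊑G : limit ⊨ᵍ (C ⊑ G)
    C⊑G Y y with limit⇒model C y
    ... | k , c = canonical-sat G G (λ m → inj₂ (derived , m)) (λ m → inj₂ (derived , m))
      where
      derived : Derived Y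
      derived = suc k , Equivalence.from T-∨ (inj₂ (fromWitness {a? = C-holds? k Y} c))

  model-complete : ∀ X F → O ⊨ (X ⊑ F) → ∃[ k ] ⟦ F ⟧ (model k) X
  model-complete X F X⊨F = limit⇒model F (X⊨F limit limit-model X (canonical-self G X))

  -- At X only the subconcepts of X and G are ever visited, so the rounds stabilise there.
  module Relevant (X : Concept) where

    N : List Concept
    N = subconcepts X ++ subconcepts G

    N-closed : ∀ {Y r Z} → Y ∈ N → (r , Z) ∈ successors Y → Z ∈ N
    N-closed {Y} Y∈N m with ∈-++⁻ (subconcepts X) Y∈N
    ... | inj₁ Y∈X = ∈-++⁺ˡ (subconcepts-trans X Y∈X (successor∈subconcepts Y m))
    ... | inj₂ Y∈G = ∈-++⁺ʳ (subconcepts X) (subconcepts-trans G Y∈G (successor∈subconcepts Y m))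

    G-closed : ∀ {r Z} → (r , Z) ∈ successors G → Z ∈ N
    G-closed m = ∈-++⁺ʳ (subconcepts X) (successor∈subconcepts G m)

    model-local : ∀ k j → (∀ {Y} → Y ∈ N → stage k Y ≡ stage j Y) →
                  ∀ F {Y} → Y ∈ N → ⟦ F ⟧ (model k) Y → ⟦ F ⟧ (model j) Y
    model-local k j agree = canonical-local G N N-closed G-closed (λ Y∈N → subst T (agree Y∈N))

    stage-local : ∀ {k j} → (∀ {Y} → Y ∈ N → stage k Y ≡ stage j Y) →
                  ∀ {Y} → Y ∈ N → stage (suc k) Y ≡ stage (suc j) Y
    stage-local {k} {j} agree {Y} Y∈N = cong₂ _∨_ (agree Y∈N)
      (T-⇔⇒≡ (transport k j agree) (transport j k (sym ∘ agree)))
      where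
      transport : ∀ k j → (∀ {Y} → Y ∈ N → stage k Y ≡ stage j Y) →
                  T (isYes (C-holds? k Y)) → T (isYes (C-holds? j Y))
      transport k j agree t =
        fromWitness {a? = C-holds? j Y} (model-local k j agree C Y∈N (toWitness {a? = C-holds? k Y} t))

    open Stabilisation stage N (λ {k} → stage-inflationary {k}) (λ {k} {j} → stage-local {k} {j}) public

  entails? : ∀ X F → Dec (O ⊨ (X ⊑ F))
  entails? X F = map′ (canonical-sound G (stage-sound bound) F) complete-at-bound
                      (canonical? G (T? ∘ stage bound) F X)
    where
    open Relevant X
    complete-at-bound : O ⊨ (X ⊑ F) → ⟦ F ⟧ (model bound) X
    complete-at-bound X⊨F with model-complete X F X⊨F
    ... | k , x = model-local (k + bound) bound (sym ∘ stabilised k) F (∈-++⁺ˡ (subconcepts-self X))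
                    (model-mono (m≤m+n k bound) F x)

subsequences : ∀ {a} {A : Set a} → List A → List (List A)
subsequences [] = [] ∷ []
subsequences (x ∷ xs) = map (x ∷_) (subsequences xs) ++ subsequences xs

filter∈subsequences : ∀ {a p} {A : Set a} {P : Pred A p} (P? : Decidable P) xs →
                      filter P? xs ∈ subsequences xs
filter∈subsequences P? [] = here refl
filter∈subsequences P? (x ∷ xs) with does (P? x)
... | true = ∈-++⁺ˡ (∈-map⁺ (x ∷_) (filter∈subsequences P? xs))
... | false = ∈-++⁺ʳ _ (filter∈subsequences P? xs)

conj : List Concept → Concept
conj [] = top
conj (X ∷ Xs) = X ⊓ conj Xs

conj-⊑∅ : ∀ {X Xs} → X ∈ Xs → conj Xs ⊑∅ X
conj-⊑∅ (here refl) I _ d (x , _) = x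
conj-⊑∅ (there X∈Xs) I M d (_ , xs) = conj-⊑∅ X∈Xs I M d xs

⊑∅-conj : ∀ Y Xs → (∀ {X} → X ∈ Xs → Y ⊑∅ X) → Y ⊑∅ conj Xs
⊑∅-conj Y [] Y⊑ I _ d y = tt
⊑∅-conj Y (X ∷ Xs) Y⊑ I M d y = Y⊑ (here refl) I M d y , ⊑∅-conj Y Xs (Y⊑ ∘ there) I M d y

generators : Concept → List Concept
normalForms : Concept → List Concept

generators (atom A) = atom A ∷ []
generators top = []
generators (X ⊓ Y) = generators X ++ generators Y
generators (ex r X) = map (ex r) (normalForms X)

normalForms X = map conj (subsequences (generators X))

atom∈generators : ∀ D {A} → A ∈ atoms D → atom A ∈ generators D
atom∈generators (atom A) (here refl) = here refl
atom∈generators (D ⊓ D') m with ∈-++⁻ (atoms D) m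
... | inj₁ m = ∈-++⁺ˡ (atom∈generators D m)
... | inj₂ m = ∈-++⁺ʳ (generators D) (atom∈generators D' m)

ex∈generators : ∀ D {r D' K} → (r , D') ∈ successors D → K ∈ normalForms D' → ex r K ∈ generators D
ex∈generators (D ⊓ D') m K∈ with ∈-++⁻ (successors D) m
... | inj₁ m = ∈-++⁺ˡ (ex∈generators D m K∈)
... | inj₂ m = ∈-++⁺ʳ (generators D) (ex∈generators D' m K∈)
ex∈generators (ex r D) (here refl) K∈ = ∈-map⁺ (ex r) K∈

normalForm : Concept → Concept → Concept
normalForm D H = conj (filter (H ⊑∅?_) (generators D))

normalForm∈normalForms : ∀ D H → normalForm D H ∈ normalForms D
normalForm∈normalForms D H = ∈-map⁺ conj (filter∈subsequences (H ⊑∅?_) (generators D))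

⊑∅-normalForm : ∀ D H → H ⊑∅ normalForm D H
⊑∅-normalForm D H = ⊑∅-conj H _ (proj₂ ∘ ∈-filter⁻ (H ⊑∅?_) {xs = generators D})

normalForm-⊑∅-generator : ∀ D H {X} → X ∈ generators D → H ⊑∅ X → normalForm D H ⊑∅ X
normalForm-⊑∅-generator D H X∈D H⊑X = conj-⊑∅ (∈-filter⁺ (H ⊑∅?_) X∈D H⊑X)

normalForm-mono : ∀ D H H' → H ⊑∅ H' → normalForm D H ⊑∅ normalForm D H'
normalForm-mono D H H' H⊑H' = ⊑∅-conj (normalForm D H) _ λ {X} X∈ →
  let X∈D , H'⊑X = ∈-filter⁻ (H' ⊑∅?_) {xs = generators D} X∈
  in normalForm-⊑∅-generator D H X∈D (⊑∅-trans H H' X H⊑H' H'⊑X)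

normalForm-⊑∅ : ∀ D H → D ⊑∅ H → normalForm D H ⊑∅ H
normalForm-⊑∅ D (atom A) D⊑A =
  normalForm-⊑∅-generator D (atom A) (atom∈generators D (⊑∅-atom D D⊑A)) (⊑∅-refl (atom A))
normalForm-⊑∅ D top _ I _ d _ = tt
normalForm-⊑∅ D (H ⊓ H') D⊑HH' I M d x =
  normalForm-⊑∅ D H (λ I M d y → proj₁ (D⊑HH' I M d y)) I M d
    (normalForm-mono D (H ⊓ H') H (λ _ _ _ → proj₁) I M d x) ,
  normalForm-⊑∅ D H' (λ I M d y → proj₂ (D⊑HH' I M d y)) I M d
    (normalForm-mono D (H ⊓ H') H' (λ _ _ _ → proj₂) I M d x)
normalForm-⊑∅ D (ex r H) D⊑∃rH with ⊑∅-ex D {r} {H} D⊑∃rH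
... | D' , m , D'⊑H = ⊑∅-trans (normalForm D (ex r H)) (ex r H') (ex r H)
  (normalForm-⊑∅-generator D (ex r H) (ex∈generators D m (normalForm∈normalForms D' H))
                                      (⊑∅-ex-mono r H H' (⊑∅-normalForm D' H)))
  (⊑∅-ex-mono r H' H (normalForm-⊑∅ D' H D'⊑H))
  where
  H' = normalForm D' H

rank : Concept → Concept → ℕ
rank D E = length (filter (E ⊑∅?_) (generators D))

rank-< : ∀ D {E E'} → D ⊑∅ E → E ⊑∅ E' → ¬ (E' ⊑∅ E) → rank D E' < rank D E
rank-< D {E} {E'} D⊑E E⊑E' E'⋢E =
  ≤∧≢⇒< (count-mono (E' ⊑∅?_) (E ⊑∅?_) (λ {X} → weaker {X}) (generators D)) λ eq →
    E'⋢E (⊑∅-trans E' (normalForm D E) E (same-rank⇒⊑∅-normalForm eq) (normalForm-⊑∅ D E D⊑E))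
  where
  weaker : ∀ {X} → E' ⊑∅ X → E ⊑∅ X
  weaker {X} = ⊑∅-trans E E' X E⊑E'
  same-rank⇒⊑∅-normalForm : rank D E' ≡ rank D E → E' ⊑∅ normalForm D E
  same-rank⇒⊑∅-normalForm eq = ⊑∅-conj E' _ λ X∈ →
    let X∈D , E⊑X = ∈-filter⁻ (E ⊑∅?_) {xs = generators D} X∈
    in count-≡⇒⊇ (E' ⊑∅?_) (E ⊑∅?_) (λ {X} → weaker {X}) eq X∈D E⊑X

≻sub-rhs : ∀ β γ → β ≻sub γ → GCI.rhs β ⊑∅ GCI.rhs γ
≻sub-rhs (C ⊑ D) (.C ⊑ D') (refl , D⊑D' , _) = D⊑D'

≻sub-strict : ∀ β γ → β ≻sub γ → ¬ (GCI.rhs γ ⊑∅ GCI.rhs β)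
≻sub-strict (C ⊑ D) (.C ⊑ D') (refl , _ , ⊭) D'⊑D = ⊭ (strengthen-rhs C D' D D'⊑D)

≻sub-rank : ∀ D₀ β γ → D₀ ⊑∅ GCI.rhs β → β ≻sub γ →
            rank D₀ (GCI.rhs γ) < rank D₀ (GCI.rhs β)
≻sub-rank D₀ β γ D₀⊑β β≻γ = rank-< D₀ D₀⊑β (≻sub-rhs β γ β≻γ) (≻sub-strict β γ β≻γ)

≻sub-irrefl : ∀ β → ¬ (β ≻sub β)
≻sub-irrefl β (_ , _ , ⊭) = ⊭ (axiom-⊨ β)

≻sub-trans : ∀ β γ δ → β ≻sub γ → γ ≻sub δ → β ≻sub δ
≻sub-trans (C ⊑ D) (.C ⊑ D') (.C ⊑ D'') (refl , D⊑D' , ⊭) (refl , D'⊑D'' , _) =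
  refl , ⊑∅-trans D D' D'' D⊑D' D'⊑D'' , ⊭ ∘ single-cut (C ⊑ D) (strengthen-rhs C D' D'' D'⊑D'')

≻sub-weakening : IsWeakening _≻sub_
≻sub-weakening = (≻sub-irrefl , ≻sub-trans) , weaker
  where
  weaker : ∀ β γ → β ≻sub γ → γ ⊊ᶜ β
  weaker (C ⊑ D) (.C ⊑ D') (refl , D⊑D' , ⊭) =
    (λ α → single-cut α (strengthen-rhs C D D' D⊑D')) , (C ⊑ D) , axiom-⊨ (C ⊑ D) , ⊭

≻sub-complete : Complete _≻sub_
≻sub-complete (C ⊑ D) ⊭D =
  (C ⊑ top) , ⊨top , refl , (λ _ _ _ _ → tt) , ⊭D ∘ tautology-cut (C ⊑ D) ⊨top
  where
  ⊨top : Tautology (C ⊑ top)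
  ⊨top _ _ _ _ = tt

≻sub-wellFounded : WellFoundedᴳ _≻sub_
≻sub-wellFounded (f , f≻) = <-irrefl refl (≤-trans (m≤n+m (suc r) _) (rank+index (suc r)))
  where
  D : ℕ → Concept
  D i = GCI.rhs (f i)
  r : ℕ
  r = rank (D 0) (D 0)
  D₀⊑ : ∀ i → D 0 ⊑∅ D i
  D₀⊑ zero = ⊑∅-refl (D 0)
  D₀⊑ (suc i) = ⊑∅-trans (D 0) (D i) (D (suc i)) (D₀⊑ i) (≻sub-rhs (f i) (f (suc i)) (f≻ i))
  rank+index : ∀ i → rank (D 0) (D i) + i ≤ r
  rank+index zero = ≤-reflexive (+-identityʳ r)
  rank+index (suc i) = begin
    rank (D 0) (D (suc i)) + suc i    ≡⟨ +-suc _ i ⟩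
    suc (rank (D 0) (D (suc i))) + i  ≤⟨ +-monoˡ-≤ i (≻sub-rank (D 0) (f i) (f (suc i)) (D₀⊑ i) (f≻ i)) ⟩
    rank (D 0) (D i) + i              ≤⟨ rank+index i ⟩
    r                                 ∎
    where open ≤-Reasoning

module OneStepDecomposition (C : Concept) where

  _≻_ : Concept → Concept → Set₁
  F ≻ G = (C ⊑ F) ≻sub (C ⊑ G)

  _≻?_ : ∀ F G → Dec (F ≻ G)
  F ≻? G = yes refl ×-dec (F ⊑∅? G) ×-dec ¬? (Saturation.entails? C G C F)

  normalForm-between : ∀ D₀ F δ G → D₀ ⊑∅ F → (C ⊑ F) ≻sub δ → δ ≻sub (C ⊑ G) →
                       F ≻ normalForm D₀ (GCI.rhs δ) × normalForm D₀ (GCI.rhs δ) ≻ G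
  normalForm-between D₀ F (.C ⊑ E) G D₀⊑F (refl , F⊑E , ⊭F) (refl , E⊑G , ⊭E) =
    (refl , ⊑∅-trans F E H F⊑E E⊑H , ⊭F ∘ single-cut (C ⊑ F) (strengthen-rhs C E H E⊑H)) ,
    (refl , ⊑∅-trans H E G H⊑E E⊑G ,
     ⊭E ∘ λ G⊨H → single-cut (C ⊑ E) G⊨H (strengthen-rhs C H E H⊑E))
    where
    H = normalForm D₀ E
    E⊑H : E ⊑∅ H
    E⊑H = ⊑∅-normalForm D₀ E
    H⊑E : H ⊑∅ E
    H⊑E = normalForm-⊑∅ D₀ E (⊑∅-trans D₀ F E D₀⊑F F⊑E)

  -- Induction on a bound n for the rank gap between F and G; both halves of a split shrink it.
  one-steps : ∀ D₀ n F G → D₀ ⊑∅ F → rank D₀ F ≤ n + rank D₀ G → F ≻ G →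
              TransClosure (OneStep _≻sub_) (C ⊑ F) (C ⊑ G)
  one-steps D₀ zero F G D₀⊑F bound F≻G =
    ⊥-elim (<-irrefl refl (<-≤-trans (≻sub-rank D₀ (C ⊑ F) (C ⊑ G) D₀⊑F F≻G) bound))
  one-steps D₀ (suc n) F G D₀⊑F bound F≻G with any? (λ H → (F ≻? H) ×-dec (H ≻? G)) (normalForms D₀)
  ... | no none = [ F≻G , (λ (δ , F≻δ , δ≻G) → none (lose (normalForm∈normalForms D₀ (GCI.rhs δ))
                                                       (normalForm-between D₀ F δ G D₀⊑F F≻δ δ≻G))) ]
  ... | yes some with find some
  ...   | H , _ , F≻H , H≻G =
    one-steps D₀ n F H D₀⊑F bound-FH F≻H ++⁺ one-steps D₀ n H G D₀⊑H bound-HG H≻G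
    where
    D₀⊑H : D₀ ⊑∅ H
    D₀⊑H = ⊑∅-trans D₀ F H D₀⊑F (≻sub-rhs (C ⊑ F) (C ⊑ H) F≻H)
    H<F : rank D₀ H < rank D₀ F
    H<F = ≻sub-rank D₀ (C ⊑ F) (C ⊑ H) D₀⊑F F≻H
    G<H : rank D₀ G < rank D₀ H
    G<H = ≻sub-rank D₀ (C ⊑ H) (C ⊑ G) D₀⊑H H≻G
    bound-FH : rank D₀ F ≤ n + rank D₀ H
    bound-FH = ≤-trans bound (≤-trans (≤-reflexive (sym (+-suc n (rank D₀ G)))) (+-monoʳ-≤ n G<H))
    bound-HG : rank D₀ H ≤ n + rank D₀ G
    bound-HG = ≤-pred (<-≤-trans H<F bound)

≻sub-oneStepGenerated : OneStepGenerated _≻sub_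
≻sub-oneStepGenerated β γ = from-one-steps β γ , to-one-steps β γ
  where
  from-one-steps : ∀ β γ → TransClosure (OneStep _≻sub_) β γ → β ≻sub γ
  from-one-steps β γ [ β≻₁γ ] = proj₁ β≻₁γ
  from-one-steps β γ (_∷_ {y = δ} β≻₁δ δ⁺γ) =
    ≻sub-trans β δ γ (proj₁ β≻₁δ) (from-one-steps δ γ δ⁺γ)
  to-one-steps : ∀ β γ → β ≻sub γ → TransClosure (OneStep _≻sub_) β γ
  to-one-steps (C ⊑ F) (.C ⊑ G) F≻G@(refl , _) =
    OneStepDecomposition.one-steps C F (rank F F) F G (⊑∅-refl F) (m≤m+n _ _) F≻G

names : Concept → List ConceptName
names (atom a) = a ∷ []
names top = []
names (C ⊓ D) = names C ++ names D
names (ex r C) = names C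

atoms⊆names : ∀ X {a} → a ∈ atoms X → a ∈ names X
atoms⊆names (atom b) m = m
atoms⊆names (X ⊓ Y) m with ∈-++⁻ (atoms X) m
... | inj₁ m = ∈-++⁺ˡ (atoms⊆names X m)
... | inj₂ m = ∈-++⁺ʳ (names X) (atoms⊆names Y m)

_[_≔_] : (I : Interp) → ConceptName → (Δ I → Set) → Interp
I [ a ≔ P ] = record I { conc = λ b → reinterpret (b ≟ a) }
  where
  reinterpret : ∀ {b} → Dec (b ≡ a) → Δ I → Set
  reinterpret {b} (yes _) = P
  reinterpret {b} (no _) = conc I b

[≔]-at : ∀ I a P d → conc (I [ a ≔ P ]) a d ≡ P d
[≔]-at I a P d rewrite ≟-diag (refl {x = a}) = refl

[≔]-fresh : ∀ I a P Z → a ∉ names Z → ∀ d → ⟦ Z ⟧ (I [ a ≔ P ]) d ⇔ ⟦ Z ⟧ I d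
[≔]-fresh I a P (atom b) a∉ d with b ≟ a
... | yes refl = ⊥-elim (a∉ (here refl))
... | no _ = ⇔-id _
[≔]-fresh I a P top a∉ d = ⇔-id _
[≔]-fresh I a P (Z ⊓ Z') a∉ d =
  [≔]-fresh I a P Z (a∉ ∘ ∈-++⁺ˡ) d ×-⇔ [≔]-fresh I a P Z' (a∉ ∘ ∈-++⁺ʳ (names Z)) d
[≔]-fresh I a P (ex r Z) a∉ d =
  mk⇔ (Product.map₂ λ {e} → Product.map₂ (Equivalence.to (fresh e)))
      (Product.map₂ λ {e} → Product.map₂ (Equivalence.from (fresh e)))
  where
  fresh : ∀ e → ⟦ Z ⟧ (I [ a ≔ P ]) e ⇔ ⟦ Z ⟧ I e
  fresh = [≔]-fresh I a P Z a∉

⊑∅-drop-fresh : ∀ a W Z → a ∉ names Z → (atom a ⊓ W) ⊑∅ Z → W ⊑∅ Z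
⊑∅-drop-fresh a W Z a∉Z aW⊑Z I _ d w =
  Equivalence.to ([≔]-fresh I a (λ _ → ⊤) Z a∉Z d)
    (aW⊑Z I' [] d (subst id (sym ([≔]-at I a (λ _ → ⊤) d)) tt ,
                   ⟦⟧-hom I I' id grow (λ _ _ _ r → r) W d w))
  where
  I' = I [ a ≔ (λ _ → ⊤) ]
  grow : ∀ b d → conc I b d → conc I' b d
  grow b d x with b ≟ a
  ... | yes _ = tt
  ... | no _ = x

-- Reinterpreting a as the singleton {d} of some d ∈ Z yields a model of a ⊑ Z.
fresh-entailment⇒⊑∅ : ∀ a Y Z → a ∉ names Y → a ∉ names Z →
                      ((atom a ⊑ Z) ∷ []) ⊨ (atom a ⊑ Y) → Z ⊑∅ Y
fresh-entailment⇒⊑∅ a Y Z a∉Y a∉Z a⊨Y I _ d z =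
  Equivalence.to ([≔]-fresh I a (_≡ d) Y a∉Y d)
    (a⊨Y I' (axiom ∷ []) d (subst id (sym ([≔]-at I a (_≡ d) d)) refl))
  where
  I' = I [ a ≔ (_≡ d) ]
  axiom : I' ⊨ᵍ (atom a ⊑ Z)
  axiom x ax with subst id ([≔]-at I a (_≡ d) x) ax
  ... | refl = Equivalence.from ([≔]-fresh I a (_≡ d) Z a∉Z d) z

infixr 5 _◅_

data Path {a ℓ} {A : Set a} (R : A → A → Set ℓ) : A → A → ℕ → Set (a ⊔ ℓ) where
  ε   : ∀ {x} → Path R x x 0
  _◅_ : ∀ {x y z m} → R x y → Path R y z m → Path R x z (suc m)

module _ {a ℓ} {A : Set a} {R : A → A → Set ℓ} where

  infixr 5 _◅◅_

  _◅◅_ : ∀ {x y z m k} → Path R x y m → Path R y z k → Path R x z (m + k)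
  ε ◅◅ q = q
  (r ◅ p) ◅◅ q = r ◅ (p ◅◅ q)

  Path-map : ∀ {b ℓ'} {B : Set b} {S : B → B → Set ℓ'} (f : A → B) →
             (∀ {x y} → R x y → S (f x) (f y)) → ∀ {x y m} → Path R x y m → Path S (f x) (f y) m
  Path-map f f-step ε = ε
  Path-map f f-step (r ◅ p) = f-step r ◅ Path-map f f-step p

module _ {_≻_ : Relᴳ} where

  vertex : ∀ {β γ m} → Path _≻_ β γ m → ℕ → GCI
  vertex {β} _ zero = β
  vertex {β} ε (suc i) = β
  vertex (_ ◅ p) (suc i) = vertex p i

  vertex-step : ∀ {β γ m} (p : Path _≻_ β γ m) i → i < m → vertex p i ≻ vertex p (suc i)
  vertex-step (β≻γ ◅ p) zero _ = β≻γ
  vertex-step (_ ◅ p) (suc i) (s≤s i<m) = vertex-step p i i<m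

  Path⇒ChainFrom : ∀ {β γ m} → Path _≻_ β γ m → ChainFrom _≻_ β m
  Path⇒ChainFrom p = vertex p , refl , vertex-step p

-- Names of u lie in 1 … n, leaving 0 free for left-hand sides and suc n free for the next level.
record Within (n : ℕ) (u : Concept) : Set where
  constructor within
  field names-within : All (λ a → 1 ≤ a × a ≤ n) (names u)

within-suc : ∀ {n u} → Within n u → Within (suc n) u
within-suc (within w) = within (All.map (Product.map₂ m≤n⇒m≤1+n) w)

within-⊓ : ∀ {n u v} → Within n u → Within n v → Within n (u ⊓ v)
within-⊓ (within w) (within w') = within (All.++⁺ w w')

within-ex : ∀ {n r u} → Within n u → Within n (ex r u)
within-ex (within w) = within w

within-top : ∀ {n} → Within n top
within-top = within []

within-new : ∀ {n} → Within (suc n) (atom (suc n))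
within-new = within ((s≤s z≤n , ≤-refl) ∷ [])

within-fresh : ∀ {n u} → Within n u → suc n ∉ names u
within-fresh (within w) a∈u = <-irrefl refl (proj₂ (All.lookup w a∈u))

within-fresh₀ : ∀ {n u} → Within n u → 0 ∉ names u
within-fresh₀ (within w) a∈u with All.lookup w a∈u
... | () , _

_≻[_]_ : Concept → ℕ → Concept → Set₁
u ≻[ n ] v = (u ⊑∅ v) × ¬ (v ⊑∅ u) × Within n u × Within n v

≻[]⇒≻sub : ∀ {n u v} → u ≻[ n ] v → (atom 0 ⊑ u) ≻sub (atom 0 ⊑ v)
≻[]⇒≻sub {u = u} {v} (u⊑v , v⋢u , wu , wv) =
  refl , u⊑v , v⋢u ∘ fresh-entailment⇒⊑∅ 0 u v (within-fresh₀ wu) (within-fresh₀ wv)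

-- A chain x₀ ≻ x₁ ≻ ⋯ ≻ top is run through twice:
--   start x₀ ≻ left x₀ x₁ ≻ ⋯ ≻ left x₀ top ≻ right x₁ ≻ ⋯ ≻ right top ≻ top.
module Doubling (n : ℕ) where

  A : Concept
  A = atom (suc n)

  start : Concept → Concept
  start x₀ = ex 0 (A ⊓ x₀)

  left : Concept → Concept → Concept
  left x₀ x = ex 0 (A ⊓ x) ⊓ ex 0 x₀

  right : Concept → Concept
  right x = ex 0 A ⊓ ex 0 x

  within-start : ∀ {x₀} → Within n x₀ → Within (suc n) (start x₀)
  within-start w₀ = within-ex (within-⊓ within-new (within-suc w₀))

  within-left : ∀ {x₀ x} → Within n x₀ → Within n x → Within (suc n) (left x₀ x)
  within-left w₀ w = within-⊓ (within-start w) (within-ex (within-suc w₀))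

  within-right : ∀ {x} → Within n x → Within (suc n) (right x)
  within-right w = within-⊓ (within-ex within-new) (within-ex (within-suc w))

  left-⋢ : ∀ x₀ x y → suc n ∉ names x → suc n ∉ names x₀ → ¬ (y ⊑∅ x) →
           ¬ (left x₀ y ⊑∅ start x)
  left-⋢ x₀ x y fresh-x fresh-x₀ y⋢x t with ⊑∅-ex (left x₀ y) {0} {A ⊓ x} t
  ... | _ , here refl , Ay⊑Ax =
    y⋢x (⊑∅-drop-fresh (suc n) y x fresh-x λ I M d w → proj₂ (Ay⊑Ax I M d w))
  ... | _ , there (here refl) , x₀⊑Ax =
    fresh-x₀ (atoms⊆names x₀ (⊑∅-atom x₀ λ I M d w → proj₁ (x₀⊑Ax I M d w)))

  right-⋢ : ∀ x y → suc n ∉ names x → ¬ (y ⊑∅ x) → ¬ (right y ⊑∅ ex 0 x)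
  right-⋢ x y fresh-x y⋢x t with ⊑∅-ex (right y) {0} {x} t
  ... | _ , here refl , A⊑x =
    y⋢x λ I M d _ → ⊑∅-drop-fresh (suc n) top x fresh-x (λ I M d w → A⊑x I M d (proj₁ w)) I M d tt
  ... | _ , there (here refl) , y⊑x = y⋢x y⊑x

  left-step : ∀ {x₀ x y} → Within n x₀ → x ≻[ n ] y → left x₀ x ≻[ suc n ] left x₀ y
  left-step {x₀} {x} {y} w₀ (x⊑y , y⋢x , wx , wy) =
    (λ { I M d ((e , re , a , x') , rest) → (e , re , a , x⊑y I M e x') , rest }) ,
    (λ t → left-⋢ x₀ x y (within-fresh wx) (within-fresh w₀) y⋢x λ I M d w → proj₁ (t I M d w)) ,
    within-left w₀ wx , within-left w₀ wy

  right-step : ∀ {x y} → x ≻[ n ] y → right x ≻[ suc n ] right y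
  right-step {x} {y} (x⊑y , y⋢x , wx , wy) =
    (λ { I M d (a , e , re , x') → a , e , re , x⊑y I M e x' }) ,
    (λ t → right-⋢ x y (within-fresh wx) y⋢x λ I M d w → proj₂ (t I M d w)) ,
    within-right wx , within-right wy

  first : ∀ {x₀ x₁} → x₀ ≻[ n ] x₁ → start x₀ ≻[ suc n ] left x₀ x₁
  first {x₀} {x₁} (x₀⊑x₁ , x₁⋢x₀ , w₀ , w₁) =
    (λ { I M d (e , re , a , x) → (e , re , a , x₀⊑x₁ I M e x) , (e , re , x) }) ,
    left-⋢ x₀ x₀ x₁ (within-fresh w₀) (within-fresh w₀) x₁⋢x₀ ,
    within-start w₀ , within-left w₀ w₁

  junction : ∀ {x₀ x₁} → x₀ ≻[ n ] x₁ → left x₀ top ≻[ suc n ] right x₁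
  junction {x₀} {x₁} (x₀⊑x₁ , x₁⋢x₀ , w₀ , w₁) =
    (λ { I M d ((e , re , a , _) , (e' , re' , x)) → (e , re , a) , (e' , re' , x₀⊑x₁ I M e' x) }) ,
    (λ t → right-⋢ x₀ x₁ (within-fresh w₀) x₁⋢x₀ λ I M d w → proj₂ (t I M d w)) ,
    within-left w₀ within-top , within-right w₁

  last : right top ≻[ suc n ] top
  last = (λ _ _ _ _ → tt) , (λ t → top⋢∅ex 0 A λ I M d w → proj₁ (t I M d w)) ,
         within-right within-top , within-top

  base : start top ≻[ suc n ] top
  base = (λ _ _ _ _ → tt) , top⋢∅ex 0 (A ⊓ top) , within-start within-top , within-top

  doubled : ∀ {x₀ m} → Within n x₀ → Path _≻[ n ]_ x₀ top m →
            Path _≻[ suc n ]_ (start x₀) top (suc (m + m))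
  doubled w₀ ε = base ◅ ε
  doubled {x₀} w₀ (_◅_ {m = m} x₀≻x₁ p) = subst (Path _≻[ suc n ]_ (start x₀) top) length-≡
    (first x₀≻x₁ ◅ Path-map (left x₀) (left-step w₀) p ◅◅
     junction x₀≻x₁ ◅ Path-map right right-step p ◅◅
     last ◅ ε)
    where
    length-≡ : suc (m + suc (m + 1)) ≡ suc (suc m + suc m)
    length-≡ = cong suc (trans (cong (λ k → m + suc k) (+-comm m 1)) (+-suc m (suc m)))

tower : ℕ → Concept
tower zero = top
tower (suc n) = Doubling.start n (tower n)

within-tower : ∀ n → Within n (tower n)
within-tower zero = within-top
within-tower (suc n) = Doubling.within-start n (within-tower n)

size-tower : ∀ n → size (tower n) ≡ suc (n + n)
size-tower zero = refl
size-tower (suc n) = cong (suc ∘ suc) (trans (size-tower n) (sym (+-suc n n)))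

tower-path : ∀ n → ∃[ m ] Path _≻[ n ]_ (tower n) top m × suc m ≡ 2 ^ n
tower-path zero = 0 , ε , refl
tower-path (suc n) with tower-path n
... | m , p , suc-m≡2^n =
  suc (m + m) , Doubling.doubled n (within-tower n) p , trans double (cong (2 *_) suc-m≡2^n)
  where
  double : suc (suc (m + m)) ≡ 2 * suc m
  double = cong suc (trans (sym (+-suc m m)) (cong (λ k → m + suc k) (sym (+-identityʳ m))))

1≤^ : ∀ {x} → 1 ≤ x → ∀ k → 1 ≤ x ^ k
1≤^ 1≤x zero = ≤-refl
1≤^ 1≤x (suc k) = *-mono-≤ 1≤x (1≤^ 1≤x k)

evalPoly-≤ : ∀ p {x} → 1 ≤ x → evalPoly p x ≤ sum p * x ^ length p
evalPoly-≤ [] _ = z≤n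
evalPoly-≤ (c ∷ cs) {x} 1≤x = begin
  c + x * evalPoly cs x                      ≤⟨ +-monoʳ-≤ c (*-monoʳ-≤ x (evalPoly-≤ cs 1≤x)) ⟩
  c + x * (sum cs * x ^ length cs)           ≡⟨ cong (c +_) (x*[s*y]≡s*[x*y] x (sum cs) (x ^ length cs)) ⟩
  c + sum cs * x ^ suc (length cs)           ≤⟨ +-monoˡ-≤ _ (m≤m*n c _ {{>-nonZero (1≤^ 1≤x (suc (length cs)))}}) ⟩
  c * x ^ suc (length cs) + sum cs * x ^ suc (length cs) ≡⟨ *-distribʳ-+ (x ^ suc (length cs)) c (sum cs) ⟨
  (c + sum cs) * x ^ suc (length cs)         ∎
  where
  open ≤-Reasoning
  x*[s*y]≡s*[x*y] : ∀ x s y → x * (s * y) ≡ s * (x * y)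
  x*[s*y]≡s*[x*y] = solve 3 (λ x s y → x :* (s :* y) := s :* (x :* y)) refl

suc≤2^ : ∀ u → suc u ≤ 2 ^ u
suc≤2^ zero = ≤-refl
suc≤2^ (suc u) = begin
  suc (suc u)       ≤⟨ +-mono-≤ (1≤^ (s≤s z≤n) u) (suc≤2^ u) ⟩
  2 ^ u + 2 ^ u     ≡⟨ cong (2 ^ u +_) (+-identityʳ (2 ^ u)) ⟨
  2 ^ suc u         ∎
  where open ≤-Reasoning

-- u is chosen so that the left-hand side is exactly u * suc d.
exponent-bound : ∀ c d → let u = c + 1 + 2 * d + d * d in
                 suc c + (u + d + 2) * d ≤ 2 ^ (u + d)
exponent-bound c d = begin
  suc c + (u + d + 2) * d    ≡⟨ lhs≡u*suc-d c d ⟩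
  u * suc d                  ≤⟨ *-monoˡ-≤ (suc d) (n≤1+n u) ⟩
  suc u * suc d              ≤⟨ *-mono-≤ (suc≤2^ u) (suc≤2^ d) ⟩
  2 ^ u * 2 ^ d              ≡⟨ ^-distribˡ-+-* 2 u d ⟨
  2 ^ (u + d)                ∎
  where
  open ≤-Reasoning
  u = c + 1 + 2 * d + d * d
  lhs≡u*suc-d : ∀ c d → suc c + (c + 1 + 2 * d + d * d + d + 2) * d ≡ (c + 1 + 2 * d + d * d) * suc d
  lhs≡u*suc-d = solve 2 (λ c d → (con 1 :+ c) :+ ((c :+ con 1 :+ con 2 :* d :+ d :* d) :+ d :+ con 2) :* d
                               := (c :+ con 1 :+ con 2 :* d :+ d :* d) :* (con 1 :+ d)) refl

exponential-dominates : ∀ p → ∃[ n ] suc (evalPoly p (suc (suc (n + n)))) < 2 ^ n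
exponential-dominates p = n , (begin
  suc (suc (evalPoly p x))      ≡⟨ +-comm 2 _ ⟩
  evalPoly p x + 2              ≤⟨ +-monoˡ-≤ 2 (evalPoly-≤ p (s≤s z≤n)) ⟩
  c * x ^ d + 2                 ≤⟨ +-monoˡ-≤ 2 (*-monoʳ-≤ c (^-monoˡ-≤ d x≤2^[s+2])) ⟩
  c * (2 ^ (s + 2)) ^ d + 2     ≡⟨ cong (λ z → c * z + 2) (^-*-assoc 2 (s + 2) d) ⟩
  c * Y + 2                     ≤⟨ +-monoʳ-≤ (c * Y) (*-monoʳ-≤ 2 (1≤^ (s≤s z≤n) ((s + 2) * d))) ⟩
  c * Y + 2 * Y                 ≡⟨ *-distribʳ-+ Y c 2 ⟨
  (c + 2) * Y                   ≤⟨ *-monoˡ-≤ Y (≤-trans (≤-reflexive (+-comm c 2)) (suc≤2^ (suc c))) ⟩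
  2 ^ suc c * Y                 ≡⟨ ^-distribˡ-+-* 2 (suc c) ((s + 2) * d) ⟨
  2 ^ (suc c + (s + 2) * d)     ≤⟨ ^-monoʳ-≤ 2 (exponent-bound c d) ⟩
  2 ^ n                         ∎)
  where
  open ≤-Reasoning
  c = sum p
  d = length p
  s = c + 1 + 2 * d + d * d + d
  n = 2 ^ s
  x = suc (suc (n + n))
  Y = 2 ^ ((s + 2) * d)
  x≤2^[s+2] : x ≤ 2 ^ (s + 2)
  x≤2^[s+2] = begin
    2 + (n + n)             ≤⟨ +-monoˡ-≤ (n + n) (+-mono-≤ (1≤^ (s≤s z≤n) s) (1≤^ (s≤s z≤n) s)) ⟩
    (n + n) + (n + n)       ≡⟨ solve 1 (λ n → (n :+ n) :+ (n :+ n) := n :* con 4) refl n ⟩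
    n * 4                   ≡⟨ ^-distribˡ-+-* 2 s 2 ⟨
    2 ^ (s + 2)             ∎

≻sub-not-polynomial : ¬ Polynomial _≻sub_
≻sub-not-polynomial (p , bounded) with exponential-dominates p
... | n , dominates with tower-path n
...   | m , path , suc-m≡2^n = <-irrefl refl (begin-strict
  2 ^ n                            ≡⟨ suc-m≡2^n ⟨
  suc m                            ≤⟨ s≤s (subst (λ k → m ≤ evalPoly p (suc k)) (size-tower n) m≤p[size]) ⟩
  suc (evalPoly p (2 + (n + n)))   <⟨ dominates ⟩
  2 ^ n                            ∎)
  where
  open ≤-Reasoning
  m≤p[size] : m ≤ evalPoly p (gciSize (atom 0 ⊑ tower n))
  m≤p[size] =
    bounded (atom 0 ⊑ tower n) m (Path⇒ChainFrom {_≻sub_} (Path-map (atom 0 ⊑_) ≻[]⇒≻sub path))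

theorem19 : IsWeakening _≻sub_ × WellFoundedᴳ _≻sub_ × Complete _≻sub_
    × OneStepGenerated _≻sub_ × ¬ Polynomial _≻sub_
theorem19 = ≻sub-weakening , ≻sub-wellFounded , ≻sub-complete , ≻sub-oneStepGenerated , ≻sub-not-polynomial
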